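{- Let $k$ be a local field, let $\mathcal{A}$ be a Banach $k$-algebra such that $\{\|a\| : a \in \mathcal{A}\} \subset \{|c| : c \in k\}$, and let $O \subset \mathcal{A}(1)$ be a closed $k^{\circ}$-subring. Let $\bar e \in \overline{\mathcal{A}}$ be an idempotent that is central in $\overline{\mathcal{A}}$ and lies in the image of $O$ under the projection $\mathcal{A}(1) \to \overline{\mathcal{A}}$. Then there exists an idempotent $e$ that is central in $\mathcal{A}$, with $e \in O$ and $e + \mathcal{A}(1-) = \bar e$.
   Context: A local field is a complete discrete valuation field $k$ with finite residue field, equipped with a fixed non-Archimedean absolute value $|\cdot|$; $k^{\circ} = \{c \in k : |c| \le 1\}$. Rings are associative and unital. A Banach $k$-algebra is a $k$-algebra $\mathcal{A}$ with a non-Archimedean norm $\|\cdot\|$ making it a complete normed $k$-vector space, with $\|ab\| \le \|a\|\,\|b\|$, $\|1\| \in \{0,1\}$, and $\|ca\| = |c|\,\|a\|$ for $c \in k$. Put $\mathcal{A}(1) = \{a : \|a\| \le 1\}$, $\mathcal{A}(1-) = \{a : \|a\| < 1\}$, and $\overline{\mathcal{A}} = \mathcal{A}(1)/\mathcal{A}(1-)$. An element is central in a ring if it commutes with every element of that ring; an idempotent is an element $e$ with $e^2=e$. -}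

module Defs where

open import Level using (0ℓ)
open import Data.Nat using (ℕ; _≥_)
open import Data.Integer as ℤ using (ℤ; +_; _⊓_)
open import Data.Product using (Σ; _×_; _,_)
open import Data.Sum using (_⊎_)
open import Data.List using (List)
open import Data.List.Relation.Unary.All using (All)
open import Data.List.Relation.Unary.Any using (Any)
open import Relation.Binary.PropositionalEquality using (_≡_; _≢_)
open import Algebra.Structures using (IsRing; IsCommutativeRing)

-- Convention: an absolute value / norm ‖x‖ is encoded by its exponent
-- v(x) ∈ ℤ ∪ {∞} with ‖x‖ = q^(-v(x)) for a fixed real q > 1
-- (‖x‖ = 0 ⇔ v(x) = ∞). Hence ‖x‖ ≤ ‖y‖ ⇔ v(y) ≤ v(x), etc.

data ℤ∞ : Set where
  fin : ℤ → ℤ∞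
  ∞   : ℤ∞

infix 4 _≤∞_
data _≤∞_ : ℤ∞ → ℤ∞ → Set where
  fin≤fin : ∀ {m n} → m ℤ.≤ n → fin m ≤∞ fin n
  _≤∞∞    : ∀ x → x ≤∞ ∞

infixl 6 _+∞_
_+∞_ : ℤ∞ → ℤ∞ → ℤ∞
fin m +∞ fin n = fin (m ℤ.+ n)
fin _ +∞ ∞     = ∞
∞     +∞ _     = ∞

min∞ : ℤ∞ → ℤ∞ → ℤ∞
min∞ (fin m) (fin n) = fin (m ⊓ n)
min∞ (fin m) ∞       = fin m
min∞ ∞       y       = y

module Metric {X : Set} (_-_ : X → X → X) (val : X → ℤ∞) where
  Cauchy : (ℕ → X) → Set
  Cauchy s = ∀ (N : ℕ) → Σ ℕ λ M → ∀ m n → m ≥ M → n ≥ M → fin (+ N) ≤∞ val (s m - s n)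

  ConvergesTo : (ℕ → X) → X → Set
  ConvergesTo s l = ∀ (N : ℕ) → Σ ℕ λ M → ∀ n → n ≥ M → fin (+ N) ≤∞ val (s n - l)

  Complete : Set
  Complete = ∀ (s : ℕ → X) → Cauchy s → Σ X λ l → ConvergesTo s l

record LocalField : Set₁ where
  infixl 6 _+_ _-_
  infixl 7 _*_
  field
    K          : Set
    _+_ _*_    : K → K → K
    -_         : K → K
    0# 1#      : K
    isCommRing : IsCommutativeRing _≡_ _+_ _*_ -_ 0# 1#
    0≢1        : 0# ≢ 1#
    inverse    : ∀ x → x ≢ 0# → Σ K λ y → x * y ≡ 1#

  _-_ : K → K → K
  x - y = x + (- y)

  field
    v        : K → ℤ∞
    v-∞⇒0    : ∀ x → v x ≡ ∞ → x ≡ 0#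
    v-0      : v 0# ≡ ∞
    v-mul    : ∀ x y → v (x * y) ≡ v x +∞ v y
    v-add    : ∀ x y → min∞ (v x) (v y) ≤∞ v (x + y)
    v-surj   : ∀ (n : ℤ) → Σ K λ c → v c ≡ fin n
    -- finite residue field k° / k°°
    residue-finite : Σ (List K) λ R →
                       All (λ r → fin (+ 0) ≤∞ v r) R ×
                       (∀ c → fin (+ 0) ≤∞ v c → Any (λ r → fin (+ 1) ≤∞ v (c - r)) R)
    complete : Metric.Complete _-_ v

-- Banach k-algebra whose norm takes values in |k|:
-- ‖a‖ = q^(-w(a)), w(a) ∈ ℤ ∪ {∞}.

record BanachAlgebra (F : LocalField) : Set₁ where
  open LocalField F using (K; v) renaming (_+_ to _+k_; _*_ to _*k_; 1# to 1k)
  infixl 6 _+_ _-_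
  infixl 7 _*_
  infixr 7 _·_
  field
    A       : Set
    _+_ _*_ : A → A → A
    -_      : A → A
    0# 1#   : A
    isRing  : IsRing _≡_ _+_ _*_ -_ 0# 1#
    _·_       : K → A → A
    ·-distribˡ : ∀ c a b → c · (a + b) ≡ c · a + c · b
    ·-distribʳ : ∀ c d a → (c +k d) · a ≡ c · a + d · a
    ·-assoc    : ∀ c d a → (c *k d) · a ≡ c · (d · a)
    ·-identity : ∀ a → 1k · a ≡ a
    ·-*-assocˡ : ∀ c a b → (c · a) * b ≡ c · (a * b)
    ·-*-assocʳ : ∀ c a b → a * (c · b) ≡ c · (a * b)

  _-_ : A → A → A
  a - b = a + (- b)

  field
    w       : A → ℤ∞
    w-∞⇒0   : ∀ a → w a ≡ ∞ → a ≡ 0#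
    w-0     : w 0# ≡ ∞
    w-add   : ∀ a b → min∞ (w a) (w b) ≤∞ w (a + b)
    w-mul   : ∀ a b → w a +∞ w b ≤∞ w (a * b)
    w-one   : w 1# ≡ fin (+ 0) ⊎ w 1# ≡ ∞
    w-smul  : ∀ c a → w (c · a) ≡ v c +∞ w a
    complete : Metric.Complete _-_ w

  InA1 : A → Set
  InA1 a = fin (+ 0) ≤∞ w a

  InA1- : A → Set
  InA1- a = fin (+ 1) ≤∞ w a

  IsIdempotent : A → Set
  IsIdempotent e = e * e ≡ e

  IsCentral : A → Set
  IsCentral e = ∀ x → e * x ≡ x * e

  record IsClosedSubring (O : A → Set) : Set where
    field
      ⊆A1   : ∀ a → O a → InA1 a
      0∈    : O 0#
      1∈    : O 1#
      +-closed : ∀ a b → O a → O b → O (a + b)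
      neg-closed : ∀ a → O a → O (- a)
      *-closed : ∀ a b → O a → O b → O (a * b)
      k°-closed : ∀ c a → fin (+ 0) ≤∞ v c → O a → O (c · a)
      closed : ∀ (s : ℕ → A) (l : A) → (∀ n → O (s n)) →
               Metric.ConvergesTo _-_ w s l → O l

{-# OPTIONS --safe #-}
-- Idempotents lift along 𝒜(1) → 𝒜(1)/𝒜(1-) by iterating x ↦ 3x² − 2x³ inside O.
-- For the defect δ(x) = x(1 − x) one has δ(3x² − 2x³) = δ(x)² (3 − 2x)(1 + 2x), and
-- the step moves x by δ(x)(2x − 1); so from ‖δ(ē₀)‖ < 1 the iterates converge
-- quadratically in the closed subring O to an idempotent e ≡ ē₀ mod 𝒜(1-).
-- For centrality, the Peirce corners y ↦ e y (1 − e) and y ↦ (1 − e) y e are idempotent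
-- k-linear maps sending 𝒜(1) into 𝒜(1-), because ē is central. As the norm takes its
-- values in |k|, every y can be rescaled into 𝒜(1), so such a map shrinks every norm by
-- the factor q⁻¹; being idempotent it must vanish, whence e y = e y e = y e.
module Submission where

open import Level using (0ℓ)
open import Function using (id)
open import Defs
open import Data.Nat as ℕ using (ℕ; zero; suc)
import Data.Nat.Properties as ℕ
open import Data.Integer as ℤ using (ℤ; +_; -[1+_])
import Data.Integer.Properties as ℤ
open import Data.Product using (Σ; _×_; _,_; proj₁; proj₂)
open import Data.Sum using (inj₁; inj₂; [_,_]′)
open import Data.Empty using (⊥-elim)
open import Algebra.Bundles using (Ring; RawRing; CommutativeRing)
open import Algebra.Structures using (IsCommutativeRing)
open import Algebra.Morphism.Structures using (IsRingMonomorphism)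
import Algebra.Morphism.RingMonomorphism as RingMonomorphism
import Algebra.Properties.Ring as RingProperties
import Algebra.Properties.AbelianGroup as AbelianGroupProperties
import Algebra.Solver.Ring.NaturalCoefficients.Default as NaturalCoefficientsSolver
import Relation.Binary.Reasoning.Setoid as SetoidReasoning

module CommutingPair {c ℓ} (R : Ring c ℓ) (a b : Ring.Carrier R)
  (ab≈ba : Ring._≈_ R (Ring._*_ R a b) (Ring._*_ R b a)) where

  open Ring R

  open RingProperties R using (-‿distribˡ-*; -‿distribʳ-*)
  open SetoidReasoning setoid

  infixl 6 _⊕_
  infixl 7 _⊗_
  data Term : Set where
    ′a ′b 𝟘 𝟙 : Term
    _⊕_ _⊗_   : Term → Term → Term
    ⊝_        : Term → Term

  ⟦_⟧ : Term → Carrier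
  ⟦ ′a ⟧    = a
  ⟦ ′b ⟧    = b
  ⟦ 𝟘 ⟧     = 0#
  ⟦ 𝟙 ⟧     = 1#
  ⟦ p ⊕ q ⟧ = ⟦ p ⟧ + ⟦ q ⟧
  ⟦ p ⊗ q ⟧ = ⟦ p ⟧ * ⟦ q ⟧
  ⟦ ⊝ p ⟧   = - ⟦ p ⟧

  commutes-with-⟦⟧ : ∀ x → x * a ≈ a * x → x * b ≈ b * x → ∀ p → x * ⟦ p ⟧ ≈ ⟦ p ⟧ * x
  commutes-with-⟦⟧ x xa xb ′a = xa
  commutes-with-⟦⟧ x xa xb ′b = xb
  commutes-with-⟦⟧ x xa xb 𝟘 = trans (zeroʳ x) (sym (zeroˡ x))
  commutes-with-⟦⟧ x xa xb 𝟙 = trans (*-identityʳ x) (sym (*-identityˡ x))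
  commutes-with-⟦⟧ x xa xb (p ⊕ q) = begin
    x * (⟦ p ⟧ + ⟦ q ⟧)     ≈⟨ distribˡ x ⟦ p ⟧ ⟦ q ⟧ ⟩
    x * ⟦ p ⟧ + x * ⟦ q ⟧   ≈⟨ +-cong (commutes-with-⟦⟧ x xa xb p) (commutes-with-⟦⟧ x xa xb q) ⟩
    ⟦ p ⟧ * x + ⟦ q ⟧ * x   ≈⟨ distribʳ x ⟦ p ⟧ ⟦ q ⟧ ⟨
    (⟦ p ⟧ + ⟦ q ⟧) * x     ∎
  commutes-with-⟦⟧ x xa xb (p ⊗ q) = begin
    x * (⟦ p ⟧ * ⟦ q ⟧)     ≈⟨ *-assoc x ⟦ p ⟧ ⟦ q ⟧ ⟨
    x * ⟦ p ⟧ * ⟦ q ⟧       ≈⟨ *-congʳ (commutes-with-⟦⟧ x xa xb p) ⟩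
    ⟦ p ⟧ * x * ⟦ q ⟧       ≈⟨ *-assoc ⟦ p ⟧ x ⟦ q ⟧ ⟩
    ⟦ p ⟧ * (x * ⟦ q ⟧)     ≈⟨ *-congˡ (commutes-with-⟦⟧ x xa xb q) ⟩
    ⟦ p ⟧ * (⟦ q ⟧ * x)     ≈⟨ *-assoc ⟦ p ⟧ ⟦ q ⟧ x ⟨
    ⟦ p ⟧ * ⟦ q ⟧ * x       ∎
  commutes-with-⟦⟧ x xa xb (⊝ p) = begin
    x * - ⟦ p ⟧             ≈⟨ -‿distribʳ-* x ⟦ p ⟧ ⟨
    - (x * ⟦ p ⟧)           ≈⟨ -‿cong (commutes-with-⟦⟧ x xa xb p) ⟩
    - (⟦ p ⟧ * x)           ≈⟨ -‿distribˡ-* ⟦ p ⟧ x ⟩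
    - ⟦ p ⟧ * x             ∎

  ⟦⟧-comm : ∀ p q → ⟦ p ⟧ * ⟦ q ⟧ ≈ ⟦ q ⟧ * ⟦ p ⟧
  ⟦⟧-comm p = commutes-with-⟦⟧ ⟦ p ⟧
    (sym (commutes-with-⟦⟧ a refl ab≈ba p)) (sym (commutes-with-⟦⟧ b (sym ab≈ba) refl p))

  termRawRing : RawRing 0ℓ ℓ
  termRawRing = record
    { Carrier = Term ; _≈_ = λ p q → ⟦ p ⟧ ≈ ⟦ q ⟧
    ; _+_ = _⊕_ ; _*_ = _⊗_ ; -_ = ⊝_ ; 0# = 𝟘 ; 1# = 𝟙 }

  ⟦⟧-isRingMonomorphism : IsRingMonomorphism termRawRing rawRing ⟦_⟧
  ⟦⟧-isRingMonomorphism = record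
    { isRingHomomorphism = record
      { isSemiringHomomorphism = record
        { isNearSemiringHomomorphism = record
          { +-isMonoidHomomorphism = record
            { isMagmaHomomorphism = record
              { isRelHomomorphism = record { cong = id }
              ; homo = λ _ _ → refl }
            ; ε-homo = refl }
          ; *-homo = λ _ _ → refl }
        ; 1#-homo = refl }
      ; -‿homo = λ _ → refl }
    ; injective = id }

  -- Terms are compared through ⟦_⟧, which makes ⟦_⟧ injective, so Term inherits the
  -- ring laws of R, and the commutativity of a and b makes it commutative.
  termRing : CommutativeRing 0ℓ ℓ
  termRing = record
    { isCommutativeRing = record
      { isRing = RingMonomorphism.isRing ⟦⟧-isRingMonomorphism isRing
      ; *-comm = ⟦⟧-comm } }

  open NaturalCoefficientsSolver (CommutativeRing.commutativeSemiring termRing)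
    using (solve; _:=_; _:+_; _:*_)

  cube-split : a * a * (a + b + b + b) + b * b * (b + a + a + a) ≈ (a + b) * (a + b) * (a + b)
  cube-split = solve 2 (λ X Y → X :* X :* (X :+ Y :+ Y :+ Y) :+ Y :* Y :* (Y :+ X :+ X :+ X)
                            := (X :+ Y) :* (X :+ Y) :* (X :+ Y)) refl ′a ′b

  cube-split-product : a * a * (a + b + b + b) * (b * b * (b + a + a + a))
                     ≈ a * b * (a * b) * ((a + b + b + b) * (b + a + a + a))
  cube-split-product = solve 2 (λ X Y → X :* X :* (X :+ Y :+ Y :+ Y) :* (Y :* Y :* (Y :+ X :+ X :+ X))
                            := X :* Y :* (X :* Y) :* ((X :+ Y :+ Y :+ Y) :* (Y :+ X :+ X :+ X))) refl ′a ′b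

  cube-split-shift : a * a * (a + b + b + b) + a * b * b ≈ a * (a + b) * (a + b) + a * b * a
  cube-split-shift = solve 2 (λ X Y → X :* X :* (X :+ Y :+ Y :+ Y) :+ X :* Y :* Y
                            := X :* (X :+ Y) :* (X :+ Y) :+ X :* Y :* X) refl ′a ′b

module Complement {c ℓ} (R : Ring c ℓ) (e : Ring.Carrier R) where

  open Ring R

  open RingProperties R using (x[y-z]≈xy-xz; [y-z]x≈yx-zx; x≈y⇒x∙y⁻¹≈ε; xyx⁻¹≈y; -0#≈0#)
  open SetoidReasoning setoid

  e′ : Carrier
  e′ = 1# - e

  e+e′≈1 : e + e′ ≈ 1#
  e+e′≈1 = trans (sym (+-assoc e 1# (- e))) (xyx⁻¹≈y e 1#)

  e*e′≈e-e*e : e * e′ ≈ e - e * e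
  e*e′≈e-e*e = trans (x[y-z]≈xy-xz e 1# e) (+-congʳ (*-identityʳ e))

  e′*e≈e-e*e : e′ * e ≈ e - e * e
  e′*e≈e-e*e = trans ([y-z]x≈yx-zx e 1# e) (+-congʳ (*-identityˡ e))

  e*e′≈e′*e : e * e′ ≈ e′ * e
  e*e′≈e′*e = trans e*e′≈e-e*e (sym e′*e≈e-e*e)

  module _ (e-idem : e * e ≈ e) where

    e*e′≈0 : e * e′ ≈ 0#
    e*e′≈0 = trans e*e′≈e-e*e (x≈y⇒x∙y⁻¹≈ε (sym e-idem))

    e′*e≈0 : e′ * e ≈ 0#
    e′*e≈0 = trans e′*e≈e-e*e (x≈y⇒x∙y⁻¹≈ε (sym e-idem))

    e′-idem : e′ * e′ ≈ e′
    e′-idem = begin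
      (1# - e) * e′       ≈⟨ [y-z]x≈yx-zx e′ 1# e ⟩
      1# * e′ - e * e′    ≈⟨ +-cong (*-identityˡ e′) (-‿cong e*e′≈0) ⟩
      e′ - 0#             ≈⟨ +-congˡ -0#≈0# ⟩
      e′ + 0#             ≈⟨ +-identityʳ e′ ⟩
      e′                  ∎

    e*x*e′≈[e*x-x*e]*e′ : ∀ x → e * x * e′ ≈ (e * x - x * e) * e′
    e*x*e′≈[e*x-x*e]*e′ x = sym (begin
      (e * x - x * e) * e′       ≈⟨ [y-z]x≈yx-zx e′ (e * x) (x * e) ⟩
      e * x * e′ - x * e * e′    ≈⟨ +-congˡ (-‿cong (*-assoc x e e′)) ⟩
      e * x * e′ - x * (e * e′)  ≈⟨ +-congˡ (-‿cong (trans (*-congˡ e*e′≈0) (zeroʳ x))) ⟩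
      e * x * e′ - 0#            ≈⟨ +-congˡ -0#≈0# ⟩
      e * x * e′ + 0#            ≈⟨ +-identityʳ (e * x * e′) ⟩
      e * x * e′                 ∎)

    e′*x*e≈e′*[x*e-e*x] : ∀ x → e′ * x * e ≈ e′ * (x * e - e * x)
    e′*x*e≈e′*[x*e-e*x] x = sym (begin
      e′ * (x * e - e * x)       ≈⟨ x[y-z]≈xy-xz e′ (x * e) (e * x) ⟩
      e′ * (x * e) - e′ * (e * x) ≈⟨ +-cong (*-assoc e′ x e) (-‿cong (*-assoc e′ e x)) ⟨
      e′ * x * e - e′ * e * x    ≈⟨ +-congˡ (-‿cong (trans (*-congʳ e′*e≈0) (zeroˡ x))) ⟩
      e′ * x * e - 0#            ≈⟨ +-congˡ -0#≈0# ⟩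
      e′ * x * e + 0#            ≈⟨ +-identityʳ (e′ * x * e) ⟩
      e′ * x * e                 ∎)

    corners-vanish⇒central : (∀ y → e * y * e′ ≈ 0#) → (∀ y → e′ * y * e ≈ 0#) →
                             ∀ y → e * y ≈ y * e
    corners-vanish⇒central eye′≈0 e′ye≈0 y = begin
      e * y                      ≈⟨ *-identityʳ (e * y) ⟨
      e * y * 1#                 ≈⟨ *-congˡ e+e′≈1 ⟨
      e * y * (e + e′)           ≈⟨ distribˡ (e * y) e e′ ⟩
      e * y * e + e * y * e′     ≈⟨ +-congˡ (trans (eye′≈0 y) (sym (e′ye≈0 y))) ⟩
      e * y * e + e′ * y * e     ≈⟨ +-cong (*-assoc e y e) (*-assoc e′ y e) ⟩
      e * (y * e) + e′ * (y * e) ≈⟨ distribʳ (y * e) e e′ ⟨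
      (e + e′) * (y * e)         ≈⟨ *-congʳ e+e′≈1 ⟩
      1# * (y * e)               ≈⟨ *-identityˡ (y * e) ⟩
      y * e                      ∎

-- Opened only from here on: the ring modules above use the setoid refl, sym and trans of R.
open import Relation.Binary.PropositionalEquality using (_≡_; refl; sym; trans; cong; cong₂; subst; subst₂; module ≡-Reasoning)

≤∞-trans : ∀ {x y z} → x ≤∞ y → y ≤∞ z → x ≤∞ z
≤∞-trans (fin≤fin p) (fin≤fin q) = fin≤fin (ℤ.≤-trans p q)
≤∞-trans (fin≤fin p) (_ ≤∞∞)     = _ ≤∞∞
≤∞-trans (x ≤∞∞)     (.∞ ≤∞∞)    = _ ≤∞∞

min∞-glb : ∀ {n x y} → fin n ≤∞ x → fin n ≤∞ y → fin n ≤∞ min∞ x y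
min∞-glb (fin≤fin p) (fin≤fin q) = fin≤fin (ℤ.⊓-glb p q)
min∞-glb (fin≤fin p) (_ ≤∞∞)     = fin≤fin p
min∞-glb (_ ≤∞∞)     q           = q

+∞-mono-≤ : ∀ {m n x y} → fin m ≤∞ x → fin n ≤∞ y → fin (m ℤ.+ n) ≤∞ x +∞ y
+∞-mono-≤ (fin≤fin p) (fin≤fin q) = fin≤fin (ℤ.+-mono-≤ p q)
+∞-mono-≤ (fin≤fin p) (_ ≤∞∞)     = _ ≤∞∞
+∞-mono-≤ (_ ≤∞∞)     q           = _ ≤∞∞

open AbelianGroupProperties ℤ.+-0-abelianGroup using ()
  renaming (\\-leftDividesʳ to -i+[i+j]≡j; identityʳ-unique to i+j≡i⇒j≡0)

+∞-cancelˡ-≤ : ∀ k {m} x → fin (k ℤ.+ m) ≤∞ fin k +∞ x → fin m ≤∞ x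
+∞-cancelˡ-≤ k {m} (fin j) (fin≤fin p) =
  fin≤fin (subst₂ ℤ._≤_ (-i+[i+j]≡j k m) (-i+[i+j]≡j k j) (ℤ.+-monoʳ-≤ (ℤ.- k) p))
+∞-cancelˡ-≤ k ∞ _ = _ ≤∞∞

+∞-identityˡ : ∀ x → fin (+ 0) +∞ x ≡ x
+∞-identityˡ (fin m) = cong fin (ℤ.+-identityˡ m)
+∞-identityˡ ∞       = refl

x+∞x≡0⇒x≡0 : ∀ x → x +∞ x ≡ fin (+ 0) → x ≡ fin (+ 0)
x+∞x≡0⇒x≡0 (fin (+ 0)) _ = refl

fin-injective : ∀ {i j} → fin i ≡ fin j → i ≡ j
fin-injective refl = refl

module Valuation (F : LocalField) where
  open LocalField F
  open IsCommutativeRing isCommRing using (isRing)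

  private
    ring : Ring 0ℓ 0ℓ
    ring = record { isRing = isRing }
  open Ring ring using (*-identityˡ)
  open RingProperties ring using (-1*x≈-x; -‿involutive)

  v-1#≡0 : v 1# ≡ fin (+ 0)
  v-1#≡0 with v 1# in v1
  ... | ∞     = ⊥-elim (0≢1 (sym (v-∞⇒0 1# v1)))
  ... | fin m = cong fin (i+j≡i⇒j≡0 m m (fin-injective (begin
    fin m +∞ fin m  ≡⟨ cong₂ _+∞_ v1 v1 ⟨
    v 1# +∞ v 1#    ≡⟨ v-mul 1# 1# ⟨
    v (1# * 1#)     ≡⟨ cong v (*-identityˡ 1#) ⟩
    v 1#            ≡⟨ v1 ⟩
    fin m           ∎)))
    where open ≡-Reasoning

  v-[-1#]≡0 : v (- 1#) ≡ fin (+ 0)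
  v-[-1#]≡0 = x+∞x≡0⇒x≡0 (v (- 1#)) (begin
    v (- 1#) +∞ v (- 1#)  ≡⟨ v-mul (- 1#) (- 1#) ⟨
    v (- 1# * - 1#)       ≡⟨ cong v (trans (-1*x≈-x (- 1#)) (-‿involutive 1#)) ⟩
    v 1#                  ≡⟨ v-1#≡0 ⟩
    fin (+ 0)             ∎)
    where open ≡-Reasoning

module Norm {F : LocalField} (𝒜 : BanachAlgebra F) where
  open BanachAlgebra 𝒜
  private
    module K = LocalField F
    module Kᵣ = IsCommutativeRing K.isCommRing

  ring : Ring 0ℓ 0ℓ
  ring = record { isRing = isRing }

  open Ring ring using (+-assoc; -‿inverseʳ; *-assoc; +-abelianGroup)
  open RingProperties ring using (x[y-z]≈xy-xz; [y-z]x≈yx-zx)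
  open AbelianGroupProperties +-abelianGroup
    using (identityʳ-unique; inverseˡ-unique; ⁻¹-anti-homo‿-; \\-leftDividesʳ; x∙y⁻¹≈ε⇒x≈y)
  open Valuation F using (v-[-1#]≡0)
  open ≡-Reasoning

  0·a≡0 : ∀ a → K.0# · a ≡ 0#
  0·a≡0 a = identityʳ-unique (K.0# · a) (K.0# · a) (begin
    K.0# · a + K.0# · a   ≡⟨ ·-distribʳ K.0# K.0# a ⟨
    (K.0# K.+ K.0#) · a   ≡⟨ cong (_· a) (Kᵣ.+-identityˡ K.0#) ⟩
    K.0# · a              ∎)

  -1·a≡-a : ∀ a → (K.- K.1#) · a ≡ - a
  -1·a≡-a a = inverseˡ-unique ((K.- K.1#) · a) a (begin
    (K.- K.1#) · a + a             ≡⟨ cong (λ t → (K.- K.1#) · a + t) (·-identity a) ⟨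
    (K.- K.1#) · a + K.1# · a      ≡⟨ ·-distribʳ (K.- K.1#) K.1# a ⟨
    (K.- K.1# K.+ K.1#) · a        ≡⟨ cong (_· a) (Kᵣ.-‿inverseˡ K.1#) ⟩
    K.0# · a                       ≡⟨ 0·a≡0 a ⟩
    0#                             ∎)

  w-neg : ∀ a → w (- a) ≡ w a
  w-neg a = begin
    w (- a)                    ≡⟨ cong w (-1·a≡-a a) ⟨
    w ((K.- K.1#) · a)         ≡⟨ w-smul (K.- K.1#) a ⟩
    K.v (K.- K.1#) +∞ w a      ≡⟨ cong (_+∞ w a) v-[-1#]≡0 ⟩
    fin (+ 0) +∞ w a           ≡⟨ +∞-identityˡ (w a) ⟩
    w a                        ∎

  Ball : ℤ → A → Set
  Ball n a = fin n ≤∞ w a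

  Near : ℤ → A → A → Set
  Near n a b = Ball n (a - b)

  ball-weaken : ∀ {m n a} → m ℤ.≤ n → Ball n a → Ball m a
  ball-weaken m≤n = ≤∞-trans (fin≤fin m≤n)

  0#∈ball : ∀ {n} → Ball n 0#
  0#∈ball = subst (fin _ ≤∞_) (sym w-0) (_ ≤∞∞)

  1#∈A1 : InA1 1#
  1#∈A1 with w-one
  ... | inj₁ w1≡0 = subst (fin (+ 0) ≤∞_) (sym w1≡0) (fin≤fin ℤ.≤-refl)
  ... | inj₂ w1≡∞ = subst (fin (+ 0) ≤∞_) (sym w1≡∞) (_ ≤∞∞)

  ball-+ : ∀ {n a b} → Ball n a → Ball n b → Ball n (a + b)
  ball-+ a∈ b∈ = ≤∞-trans (min∞-glb a∈ b∈) (w-add _ _)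

  ball-neg : ∀ {n a} → Ball n a → Ball n (- a)
  ball-neg {n} {a} = subst (fin n ≤∞_) (sym (w-neg a))

  ball-- : ∀ {n a b} → Ball n a → Ball n b → Ball n (a - b)
  ball-- a∈ b∈ = ball-+ a∈ (ball-neg b∈)

  ball-* : ∀ {m n a b} → Ball m a → Ball n b → Ball (m ℤ.+ n) (a * b)
  ball-* a∈ b∈ = ≤∞-trans (+∞-mono-≤ a∈ b∈) (w-mul _ _)

  ball-*ˡ : ∀ {n a b} → InA1 a → Ball n b → Ball n (a * b)
  ball-*ˡ {n} a∈ b∈ = subst (λ k → Ball k _) (ℤ.+-identityˡ n) (ball-* a∈ b∈)

  ball-*ʳ : ∀ {n a b} → Ball n a → InA1 b → Ball n (a * b)
  ball-*ʳ {n} a∈ b∈ = subst (λ k → Ball k _) (ℤ.+-identityʳ n) (ball-* a∈ b∈)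

  ball-all⇒≡0 : ∀ {a} → (∀ (N : ℕ) → Ball (+ N) a) → a ≡ 0#
  ball-all⇒≡0 {a} a∈ with w a in wa
  ... | ∞ = w-∞⇒0 a wa
  ... | fin m with a∈ (suc ℤ.∣ m ∣)
  ...   | fin≤fin p = ⊥-elim (ℤ.<-irrefl refl (ℤ.<-≤-trans (m<1+∣m∣ m) p))
    where
    m<1+∣m∣ : ∀ m → m ℤ.< + suc ℤ.∣ m ∣
    m<1+∣m∣ (+ k)    = ℤ.+<+ (ℕ.n<1+n k)
    m<1+∣m∣ -[1+ k ] = ℤ.-<+

  ball-improving⇒≡0 : ∀ {a} → (∀ n → Ball n a → Ball (+ 1 ℤ.+ n) a) → a ≡ 0#
  ball-improving⇒≡0 {a} improve with w a in wa
  ... | ∞ = w-∞⇒0 a wa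
  ... | fin m with improve m (fin≤fin ℤ.≤-refl)
  ...   | fin≤fin p = ⊥-elim (ℤ.<-irrefl refl (ℤ.suc[i]≤j⇒i<j p))

  a-b+[b-c]≡a-c : ∀ a b c → (a - b) + (b - c) ≡ a - c
  a-b+[b-c]≡a-c a b c = begin
    (a - b) + (b - c)    ≡⟨ +-assoc a (- b) (b - c) ⟩
    a + (- b + (b - c))  ≡⟨ cong (λ t → a + t) (\\-leftDividesʳ b (- c)) ⟩
    a - c                ∎

  near-refl : ∀ {n a} → Near n a a
  near-refl {n} {a} = subst (Ball n) (sym (-‿inverseʳ a)) 0#∈ball

  near-sym : ∀ {n a b} → Near n a b → Near n b a
  near-sym {n} {a} {b} p = subst (Ball n) (⁻¹-anti-homo‿- a b) (ball-neg p)

  near-trans : ∀ {n a b c} → Near n a b → Near n b c → Near n a c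
  near-trans {n} {a} {b} {c} p q = subst (Ball n) (a-b+[b-c]≡a-c a b c) (ball-+ p q)

  near-* : ∀ {n a b c d} → InA1 a → InA1 d → Near n a b → Near n c d → Near n (a * c) (b * d)
  near-* {n} {a} {b} {c} {d} a∈ d∈ a≈b c≈d = near-trans
    (subst (Ball n) (x[y-z]≈xy-xz a c d) (ball-*ˡ a∈ c≈d))
    (subst (Ball n) ([y-z]x≈yx-zx d a b) (ball-*ʳ a≈b d∈))

  near-all⇒≡ : ∀ {a b} → (∀ (N : ℕ) → Near (+ N) a b) → a ≡ b
  near-all⇒≡ {a} {b} a≈b = x∙y⁻¹≈ε⇒x≈y a b (ball-all⇒≡0 a≈b)

  module _ (s : ℕ → A) (step-near : ∀ n → Near (+ suc n) (s (suc n)) (s n)) where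

    near-telescope : ∀ k n → Near (+ suc n) (s (k ℕ.+ n)) (s n)
    near-telescope zero    n = near-refl
    near-telescope (suc k) n = near-trans
      (ball-weaken (ℤ.+≤+ (ℕ.s≤s (ℕ.m≤n+m n k))) (step-near (k ℕ.+ n))) (near-telescope k n)

    near-later : ∀ {N m n} → N ℕ.≤ n → n ℕ.≤ m → Near (+ N) (s m) (s n)
    near-later {N} {m} {n} N≤n n≤m = ball-weaken (ℤ.+≤+ (ℕ.m≤n⇒m≤1+n N≤n))
      (subst (λ j → Near _ (s j) (s n)) (ℕ.m∸n+n≡m n≤m) (near-telescope (m ℕ.∸ n) n))

    cauchy : Metric.Cauchy _-_ w s
    cauchy N = N , λ m n N≤m N≤n →
      [ near-later N≤n , (λ m≤n → near-sym (near-later N≤m m≤n)) ]′ (ℕ.≤-total n m)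

    limit-near-start : ∀ {l} → Metric.ConvergesTo _-_ w s l → Near (+ 1) l (s 0)
    limit-near-start {l} conv = near-trans (near-sym (s-near-l M ℕ.≤-refl))
      (subst (λ j → Near (+ 1) (s j) (s 0)) (ℕ.+-identityʳ M) (near-telescope M 0))
      where
      M : ℕ
      M = proj₁ (conv 1)
      s-near-l : ∀ n → n ℕ.≥ M → Near (+ 1) (s n) l
      s-near-l = proj₂ (conv 1)

  limit-idempotent : ∀ {s e} → Metric.ConvergesTo _-_ w s e → InA1 e → (∀ n → InA1 (s n)) →
                     (∀ n → Near (+ n) (s n * s n) (s n)) → e * e ≡ e
  limit-idempotent {s} {e} conv e∈ s∈ s-idem = near-all⇒≡ e*e≈e
    where
    e*e≈e : ∀ N → Near (+ N) (e * e) e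
    e*e≈e N = near-trans (near-* e∈ (s∈ n) e≈sₙ e≈sₙ)
      (near-trans (ball-weaken (ℤ.+≤+ (ℕ.m≤n+m N M)) (s-idem n)) (near-sym e≈sₙ))
      where
      M n : ℕ
      M = proj₁ (conv N)
      n = M ℕ.+ N
      e≈sₙ : Near (+ N) e (s n)
      e≈sₙ = near-sym (proj₂ (conv N) n (ℕ.m≤m+n M N))

  module _ (P : A → A) (P-homogeneous : ∀ c y → P (c · y) ≡ c · P y)
           (P-idempotent : ∀ y → P (P y) ≡ P y)
           (P-contracts : ∀ y → InA1 y → InA1- (P y)) where

    contraction-improves-balls : ∀ n y → Ball n y → Ball (+ 1 ℤ.+ n) (P y)
    -- Rescale y into 𝒜(1) by a scalar c with v c = -n, which exists as v is onto ℤ.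
    contraction-improves-balls n y y∈ with K.v-surj (ℤ.- n)
    ... | c , vc≡-n = +∞-cancelˡ-≤ (ℤ.- n) (w (P y))
      (subst₂ _≤∞_ 1≡-n+[1+n] w[P[c·y]] (P-contracts (c · y) c·y∈))
      where
      w[c·y] : w (c · y) ≡ fin (ℤ.- n) +∞ w y
      w[c·y] = trans (w-smul c y) (cong (_+∞ w y) vc≡-n)
      c·y∈ : InA1 (c · y)
      c·y∈ = subst₂ _≤∞_ (cong fin (ℤ.+-inverseˡ n)) (sym w[c·y]) (+∞-mono-≤ (fin≤fin ℤ.≤-refl) y∈)
      w[P[c·y]] : w (P (c · y)) ≡ fin (ℤ.- n) +∞ w (P y)
      w[P[c·y]] = trans (cong w (P-homogeneous c y)) (trans (w-smul c (P y)) (cong (_+∞ w (P y)) vc≡-n))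
      1≡-n+[1+n] : fin (+ 1) ≡ fin (ℤ.- n ℤ.+ (+ 1 ℤ.+ n))
      1≡-n+[1+n] = cong fin (sym (trans (cong (λ i → ℤ.- n ℤ.+ i) (ℤ.+-comm (+ 1) n))
                                        (-i+[i+j]≡j n (+ 1))))

    contracting-idempotent≡0 : ∀ y → P y ≡ 0#
    contracting-idempotent≡0 y = ball-improving⇒≡0 λ n Py∈ →
      subst (Ball _) (P-idempotent y) (contraction-improves-balls n (P y) Py∈)

  ReductionCentral : A → Set
  ReductionCentral e = ∀ x → InA1 x → Near (+ 1) (e * x) (x * e)

  reduction-central-near : ∀ {e e₀} → InA1 e → Near (+ 1) e e₀ →
                           ReductionCentral e₀ → ReductionCentral e
  reduction-central-near e∈ e≈e₀ e₀-central x x∈ = near-trans (near-* e∈ x∈ e≈e₀ near-refl)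
    (near-trans (e₀-central x x∈) (near-* x∈ e∈ near-refl (near-sym e≈e₀)))

  corner-vanishes : ∀ u u′ → u * u ≡ u → u′ * u′ ≡ u′ →
                    (∀ x → InA1 x → InA1- (u * x * u′)) → ∀ y → u * y * u′ ≡ 0#
  corner-vanishes u u′ u-idem u′-idem =
    contracting-idempotent≡0 (λ y → u * y * u′) homogeneous idempotent
    where
    homogeneous : ∀ c y → u * (c · y) * u′ ≡ c · (u * y * u′)
    homogeneous c y = trans (cong (_* u′) (·-*-assocʳ c u y)) (·-*-assocˡ c (u * y) u′)
    idempotent : ∀ y → u * (u * y * u′) * u′ ≡ u * y * u′
    idempotent y = begin
      u * (u * y * u′) * u′    ≡⟨ cong (_* u′) (*-assoc u (u * y) u′) ⟨
      u * (u * y) * u′ * u′    ≡⟨ cong (λ t → t * u′ * u′) (*-assoc u u y) ⟨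
      u * u * y * u′ * u′      ≡⟨ cong (λ t → t * y * u′ * u′) u-idem ⟩
      u * y * u′ * u′          ≡⟨ *-assoc (u * y) u′ u′ ⟩
      u * y * (u′ * u′)        ≡⟨ cong (u * y *_) u′-idem ⟩
      u * y * u′               ∎

  reduction-central⇒central : ∀ {e} → IsIdempotent e → InA1 e → ReductionCentral e → IsCentral e
  reduction-central⇒central {e} e-idem e∈ e-central =
    corners-vanish⇒central e-idem
      (corner-vanishes e e′ e-idem (e′-idem e-idem) λ x x∈ →
        subst (Ball (+ 1)) (sym (e*x*e′≈[e*x-x*e]*e′ e-idem x)) (ball-*ʳ (e-central x x∈) e′∈))
      (corner-vanishes e′ e (e′-idem e-idem) e-idem λ x x∈ →
        subst (Ball (+ 1)) (sym (e′*x*e≈e′*[x*e-e*x] e-idem x))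
          (ball-*ˡ e′∈ (near-sym (e-central x x∈))))
    where
    open Complement ring e
    e′∈ : InA1 e′
    e′∈ = ball-- 1#∈A1 e∈

module IdempotentLifting {F : LocalField} (𝒜 : BanachAlgebra F)
  {O : BanachAlgebra.A 𝒜 → Set} (O-subring : BanachAlgebra.IsClosedSubring 𝒜 O) where

  open BanachAlgebra 𝒜
  open IsClosedSubring O-subring
  open Norm 𝒜
  open Ring ring using (+-assoc; +-comm; *-identityʳ; +-abelianGroup)
  open AbelianGroupProperties +-abelianGroup using (x≈z//y; xyx⁻¹≈y)
  open ≡-Reasoning

  defect : A → A
  defect x = x * (1# - x)

  -- x ↦ 3x² − 2x³, written so that it and its complement are x²(x + 3x′) and x′²(x′ + 3x).
  lift-step : A → A
  lift-step x = x * x * (x + x′ + x′ + x′)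
    where
    x′ : A
    x′ = 1# - x

  defect-factor : A → A
  defect-factor x = (x + x′ + x′ + x′) * (x′ + x + x + x)
    where
    x′ : A
    x′ = 1# - x

  u+v≡c+d⇒u-c≡d-v : ∀ u v c d → u + v ≡ c + d → u - c ≡ d - v
  u+v≡c+d⇒u-c≡d-v u v c d u+v≡c+d = begin
    u - c              ≡⟨ cong (_- c) (x≈z//y u v (c + d) u+v≡c+d) ⟩
    c + d - v - c      ≡⟨ cong (_- c) (+-assoc c d (- v)) ⟩
    c + (d - v) - c    ≡⟨ xyx⁻¹≈y c (d - v) ⟩
    d - v              ∎

  module _ (x : A) where
    open Complement ring x using (e+e′≈1; e*e′≈e′*e; e*e′≈e-e*e)
    open CommutingPair ring x (1# - x) e*e′≈e′*e

    private
      x′ : A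
      x′ = 1# - x

      complement-step : A
      complement-step = x′ * x′ * (x′ + x + x + x)

    1-lift-step : 1# - lift-step x ≡ complement-step
    1-lift-step = sym (x≈z//y complement-step (lift-step x) 1# (begin
      complement-step + lift-step x      ≡⟨ +-comm complement-step (lift-step x) ⟩
      lift-step x + complement-step      ≡⟨ cube-split ⟩
      (x + x′) * (x + x′) * (x + x′)     ≡⟨ cong (λ t → t * t * t) e+e′≈1 ⟩
      1# * 1# * 1#                       ≡⟨ trans (*-identityʳ (1# * 1#)) (*-identityʳ 1#) ⟩
      1#                                 ∎))

    defect-lift-step : defect (lift-step x) ≡ defect x * defect x * defect-factor x
    defect-lift-step = trans (cong (lift-step x *_) 1-lift-step) cube-split-product

    lift-step-displacement : lift-step x - x ≡ defect x * x - defect x * x′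
    lift-step-displacement = u+v≡c+d⇒u-c≡d-v (lift-step x) (defect x * x′) x (defect x * x) (begin
      lift-step x + defect x * x′               ≡⟨ cube-split-shift ⟩
      x * (x + x′) * (x + x′) + defect x * x    ≡⟨ cong (λ t → x * t * t + defect x * x) e+e′≈1 ⟩
      x * 1# * 1# + defect x * x                ≡⟨ cong (_+ defect x * x) x*1*1≡x ⟩
      x + defect x * x                          ∎)
      where
      x*1*1≡x : x * 1# * 1# ≡ x
      x*1*1≡x = trans (*-identityʳ (x * 1#)) (*-identityʳ x)

    defect≡x-x*x : defect x ≡ x - x * x
    defect≡x-x*x = e*e′≈e-e*e

  O-1- : ∀ {x} → O x → O (1# - x)
  O-1- x∈O = +-closed _ _ 1∈ (neg-closed _ x∈O)

  O-x+3y : ∀ {x y} → O x → O y → O (x + y + y + y)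
  O-x+3y x∈O y∈O = +-closed _ _ (+-closed _ _ (+-closed _ _ x∈O y∈O) y∈O) y∈O

  O-lift-step : ∀ {x} → O x → O (lift-step x)
  O-lift-step x∈O = *-closed _ _ (*-closed _ _ x∈O x∈O) (O-x+3y x∈O (O-1- x∈O))

  O-defect-factor : ∀ {x} → O x → O (defect-factor x)
  O-defect-factor x∈O = *-closed _ _ (O-x+3y x∈O (O-1- x∈O)) (O-x+3y (O-1- x∈O) x∈O)

  module Lift (e₀ : A) (e₀∈O : O e₀) (e₀-almost-idem : Near (+ 1) (e₀ * e₀) e₀) where

    approximation : ℕ → A
    approximation zero    = e₀
    approximation (suc n) = lift-step (approximation n)

    approximation∈O : ∀ n → O (approximation n)
    approximation∈O zero    = e₀∈O
    approximation∈O (suc n) = O-lift-step (approximation∈O n)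

    approximation∈A1 : ∀ n → InA1 (approximation n)
    approximation∈A1 n = ⊆A1 _ (approximation∈O n)

    defect-approximation : ∀ n → Ball (+ suc n) (defect (approximation n))
    defect-approximation zero    = subst (Ball (+ 1)) (sym (defect≡x-x*x e₀)) (near-sym e₀-almost-idem)
    defect-approximation (suc n) = subst (Ball _) (sym (defect-lift-step (approximation n)))
      (ball-weaken (ℤ.+≤+ (ℕ.s≤s (ℕ.m≤n+m (suc n) n)))
        (ball-*ʳ (ball-* (defect-approximation n) (defect-approximation n))
                 (⊆A1 _ (O-defect-factor (approximation∈O n)))))

    approximation-step-near : ∀ n → Near (+ suc n) (approximation (suc n)) (approximation n)
    approximation-step-near n = subst (Ball _) (sym (lift-step-displacement (approximation n)))
      (ball-- (ball-*ʳ (defect-approximation n) (approximation∈A1 n))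
              (ball-*ʳ (defect-approximation n) (⊆A1 _ (O-1- (approximation∈O n)))))

    approximation-almost-idem : ∀ n → Near (+ n) (approximation n * approximation n) (approximation n)
    approximation-almost-idem n = ball-weaken (ℤ.+≤+ (ℕ.n≤1+n n))
      (near-sym (subst (Ball _) (defect≡x-x*x (approximation n)) (defect-approximation n)))

    limit : Σ A (Metric.ConvergesTo _-_ w approximation)
    limit = complete approximation (cauchy approximation approximation-step-near)

    lift : A
    lift = proj₁ limit

    approximation→lift : Metric.ConvergesTo _-_ w approximation lift
    approximation→lift = proj₂ limit

    lift∈O : O lift
    lift∈O = closed approximation lift approximation∈O approximation→lift

    lift-idempotent : IsIdempotent lift
    lift-idempotent =
      limit-idempotent approximation→lift (⊆A1 lift lift∈O) approximation∈A1 approximation-almost-idem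

    lift-near : Near (+ 1) lift e₀
    lift-near = limit-near-start approximation approximation-step-near approximation→lift

corollary3p2 : (F : LocalField) (𝒜 : BanachAlgebra F) (O : BanachAlgebra.A 𝒜 → Set) →
    BanachAlgebra.IsClosedSubring 𝒜 O →
    -- ē = ē₀ + 𝒜(1-) with ē₀ ∈ O (ē lies in the image of O)
    (ē₀ : BanachAlgebra.A 𝒜) → O ē₀ →
    -- ē is idempotent in the reduction
    BanachAlgebra.InA1- 𝒜 (BanachAlgebra._-_ 𝒜 (BanachAlgebra._*_ 𝒜 ē₀ ē₀) ē₀) →
    -- ē is central in the reduction
    (∀ x → BanachAlgebra.InA1 𝒜 x →
      BanachAlgebra.InA1- 𝒜 (BanachAlgebra._-_ 𝒜 (BanachAlgebra._*_ 𝒜 ē₀ x) (BanachAlgebra._*_ 𝒜 x ē₀))) →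
    Σ (BanachAlgebra.A 𝒜) λ e →
      BanachAlgebra.IsIdempotent 𝒜 e × BanachAlgebra.IsCentral 𝒜 e × O e ×
      BanachAlgebra.InA1- 𝒜 (BanachAlgebra._-_ 𝒜 e ē₀)
corollary3p2 F 𝒜 O O-subring ē₀ ē₀∈O ē₀-idem ē₀-central =
  lift , lift-idempotent , lift-central , lift∈O , lift-near
  where
  open BanachAlgebra 𝒜 using (InA1; IsCentral)
  open BanachAlgebra.IsClosedSubring O-subring using (⊆A1)
  open Norm 𝒜 using (reduction-central⇒central; reduction-central-near)
  open IdempotentLifting.Lift 𝒜 O-subring ē₀ ē₀∈O ē₀-idem using (lift; lift-idempotent; lift∈O; lift-near)

  lift∈A1 : InA1 lift
  lift∈A1 = ⊆A1 lift lift∈O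

  lift-central : IsCentral lift
  lift-central = reduction-central⇒central lift-idempotent lift∈A1
    (reduction-central-near lift∈A1 lift-near ē₀-central)
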